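{- For every integer $n > 1$, $j(n) \equiv 0 \pmod 2$.
   Context: A 01-partition (jagged partition) of a non-negative integer $n$ is a finite sequence $(n_1,\dots,n_m)$ of non-negative integers with $\sum_i n_i = n$, whose last entry satisfies $n_m \geq 1$, and such that $n_j \geq n_{j+1}-1$ and $n_j \geq n_{j+2}$ whenever the indices are in range. The empty sequence is the unique 01-partition of $0$. $j(n)$ denotes the number of 01-partitions of $n$. -}

module Defs where

open import Data.Nat using (ℕ; zero; suc; _≤_; _∸_)
open import Data.List using (List; []; _∷_)
open import Data.Nat.ListAction using (sum)
open import Data.Product using (_×_)
open import Data.Unit using (⊤)
open import Data.Empty using (⊥)
open import Relation.Binary.PropositionalEquality using (_≡_)

-- Local conditions of a 01-partition (n_1, ..., n_m), read left to right:
--   n_j ≥ n_{j+1} - 1   (truncated subtraction is fine since n_j ≥ 0)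
--   n_j ≥ n_{j+2}
--   n_m ≥ 1 (last entry positive)
JaggedConds : List ℕ → Set
JaggedConds []                 = ⊤
JaggedConds (a ∷ [])           = 1 ≤ a
JaggedConds (a ∷ b ∷ [])       = (b ∸ 1 ≤ a) × JaggedConds (b ∷ [])
JaggedConds (a ∷ b ∷ c ∷ rest) = (b ∸ 1 ≤ a) × (c ≤ a) × JaggedConds (b ∷ c ∷ rest)

Is01Partition : ℕ → List ℕ → Set
Is01Partition n s = (sum s ≡ n) × JaggedConds s

-- A 01-partition with entries at most K reads, from the left,
--   K^{a_K} ((K−1) K)^{b_K} (K−1)^{a_{K−1}} ((K−2) (K−1))^{b_{K−1}} ⋯ 1^{a_1} (0 1)^{b_1}
-- for unique multiplicities a_k, b_k, and its sum is Σ_k (k a_k + (2k−1) b_k). So j(n) counts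
-- partitions of n into parts 1, 2, 3, … and a second kind of odd parts 1, 3, 5, …, i.e.
-- Σ j(n) qⁿ = ∏_k 1/((1−q^k)(1−q^{2k−1})).
-- Modulo 2, (1−q^w)^{−2} ≡ (1−q^{2w})^{−1}. Among the parts ≤ n every odd part occurs twice
-- and every even part once, so pairing up the odd parts leaves only even parts: the parts
-- 2, 4, …, 2k and 2, 6, …, 4k−2 give j(2k) ≡ j(k), while for n = 2k+1 no part can reach an
-- odd total, so j(2k+1) is even. Writing n = 2^e (2k+1) shows j(n) is even for all n ≥ 1.

{-# OPTIONS --safe #-}
module Submission where

open import Defs
open import Data.Nat using (ℕ; zero; suc; _+_; _*_; _∸_; _≤_; _<_; z≤n; s≤s; s≤s⁻¹; _≤?_; _≟_; NonZero; nonZero; parity)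
open import Data.Nat.Properties
open import Data.Nat.Divisibility using (_∣_; _∣0; ∣-refl; ∣m∣n⇒∣m+n)
open import Data.Nat.Induction using (<-rec)
open import Data.Nat.ListAction using (sum)
open import Data.Nat.Tactic.RingSolver using (solve-∀)
open import Algebra.Properties.CommutativeSemigroup +-commutativeSemigroup using () renaming (interchange to +-interchange)
open import Data.Parity.Base as ℙ using (0ℙ)
open import Data.Parity.Properties as ℙ using (+-homo-+; p+p≡0ℙ)
open import Data.List using (List; []; _∷_; _++_; map; length; zipWith; replicate)
open import Data.List.Properties using (length-++; length-map; ∷-injectiveˡ; ∷-injectiveʳ; ++-assoc; map-++)
open import Data.List.Relation.Unary.Unique.Propositional using (Unique)
import Data.List.Relation.Unary.Unique.Propositional.Properties as Unique
open import Data.List.Membership.Propositional using (_∈_)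
open import Data.List.Membership.Propositional.Properties using (∈-map⁺; ∈-map⁻; ∈-++⁻; ∈-++⁺ˡ; ∈-++⁺ʳ)
open import Data.List.Relation.Unary.Any using (here; there)
open import Data.List.Relation.Unary.All using (All; []; _∷_)
import Data.List.Relation.Unary.All as All
import Data.List.Relation.Unary.All.Properties as All
open import Data.List.Relation.Unary.AllPairs using ([]; _∷_)
open import Data.List.Relation.Binary.Permutation.Propositional using (_↭_; prep; ↭-refl; ↭-sym; ↭-trans; ↭-reflexive)
import Data.List.Relation.Binary.Permutation.Propositional as ↭
open import Data.List.Relation.Binary.Permutation.Propositional.Properties using (++-comm; ++⁺; ++⁺ˡ; ++⁺ʳ; map⁺) renaming (shift to ↭-shift)
open import Data.Product using (Σ; _×_; _,_; proj₁; proj₂)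
open import Data.Sum using (inj₁; inj₂)
open import Data.Unit using (⊤; tt)
open import Data.Empty using (⊥-elim)
open import Function.Bundles using (_⇔_; mk⇔)
open import Relation.Nullary using (yes; no; ¬_)
open import Relation.Nullary.Negation using (contradiction)
open import Relation.Binary.PropositionalEquality

private variable A : Set

infix 4 _≡₂_

_≡₂_ : ℕ → ℕ → Set
m ≡₂ n = parity m ≡ parity n

≡₂-+ : ∀ a a′ b b′ → a ≡₂ a′ → b ≡₂ b′ → a + b ≡₂ a′ + b′
≡₂-+ a a′ b b′ p q =
  trans (+-homo-+ a b) (trans (cong₂ ℙ._+_ p q) (sym (+-homo-+ a′ b′)))

+-double-≡₂ : ∀ a z → a + (z + z) ≡₂ a
+-double-≡₂ a z = begin
  parity (a + (z + z))               ≡⟨ +-homo-+ a (z + z) ⟩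
  parity a ℙ.+ parity (z + z)        ≡⟨ cong (parity a ℙ.+_) (trans (+-homo-+ z z) (p+p≡0ℙ (parity z))) ⟩
  parity a ℙ.+ 0ℙ                    ≡⟨ ℙ.+-identityʳ (parity a) ⟩
  parity a                           ∎
  where open ≡-Reasoning

parity≡0ℙ⇒2∣ : ∀ n → parity n ≡ 0ℙ → 2 ∣ n
parity≡0ℙ⇒2∣ zero          _      = 2 ∣0
parity≡0ℙ⇒2∣ (suc zero)    ()
parity≡0ℙ⇒2∣ (suc (suc n)) even-n = ∣m∣n⇒∣m+n (∣-refl {2}) (parity≡0ℙ⇒2∣ n even-n)

∑≤ : ℕ → (ℕ → ℕ) → ℕ
∑≤ zero    f = f zero
∑≤ (suc k) f = ∑≤ k f + f (suc k)

syntax ∑≤ k (λ x → e) = ∑[ x ≤ k ] e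

∑≤-cong : ∀ k {f g} → f ≗ g → ∑≤ k f ≡ ∑≤ k g
∑≤-cong zero    f≗g = f≗g zero
∑≤-cong (suc k) f≗g = cong₂ _+_ (∑≤-cong k f≗g) (f≗g (suc k))

∑≤-cong-≡₂ : ∀ k f g → (∀ x → f x ≡₂ g x) → ∑≤ k f ≡₂ ∑≤ k g
∑≤-cong-≡₂ zero    f g f≡₂g = f≡₂g zero
∑≤-cong-≡₂ (suc k) f g f≡₂g =
  ≡₂-+ (∑≤ k f) (∑≤ k g) (f (suc k)) (g (suc k)) (∑≤-cong-≡₂ k f g f≡₂g) (f≡₂g (suc k))

∑≤-zero : ∀ k → ∑[ x ≤ k ] 0 ≡ 0
∑≤-zero zero    = refl
∑≤-zero (suc k) = cong (_+ 0) (∑≤-zero k)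

∑≤-distrib-+ : ∀ k f g → ∑[ x ≤ k ] (f x + g x) ≡ ∑≤ k f + ∑≤ k g
∑≤-distrib-+ zero    f g = refl
∑≤-distrib-+ (suc k) f g = trans (cong (_+ (f (suc k) + g (suc k))) (∑≤-distrib-+ k f g))
  (+-interchange (∑≤ k f) (∑≤ k g) (f (suc k)) (g (suc k)))

∑≤-head : ∀ k f → (∀ x → f (suc x) ≡ 0) → ∑≤ k f ≡ f 0
∑≤-head zero    f tail≡0 = refl
∑≤-head (suc k) f tail≡0 =
  trans (cong₂ _+_ (∑≤-head k f tail≡0) (tail≡0 k)) (+-identityʳ (f 0))

∑≤-comm : ∀ k l (T : ℕ → ℕ → ℕ) → ∑[ x ≤ k ] ∑[ y ≤ l ] T x y ≡ ∑[ y ≤ l ] ∑[ x ≤ k ] T x y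
∑≤-comm zero    l T = refl
∑≤-comm (suc k) l T = trans (cong (_+ ∑≤ l (T (suc k))) (∑≤-comm k l T))
  (sym (∑≤-distrib-+ l (λ y → ∑[ x ≤ k ] T x y) (T (suc k))))

-- The off-diagonal terms of a symmetric double sum come in equal pairs.
∑≤-symmetric-≡₂ : ∀ k (T : ℕ → ℕ → ℕ) → (∀ x y → T x y ≡ T y x) →
  ∑[ x ≤ k ] ∑[ y ≤ k ] T x y ≡₂ ∑[ x ≤ k ] T x x
∑≤-symmetric-≡₂ zero    T T-sym = refl
∑≤-symmetric-≡₂ (suc k) T T-sym = begin
  parity (∑[ x ≤ suc k ] ∑[ y ≤ suc k ] T x y) ≡⟨ cong parity split ⟩
  parity ((D + t) + (Z + Z))                   ≡⟨ +-double-≡₂ (D + t) Z ⟩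
  parity (D + t)                               ≡⟨ ≡₂-+ D (∑[ x ≤ k ] T x x) t t (∑≤-symmetric-≡₂ k T T-sym) refl ⟩
  parity (∑[ x ≤ suc k ] T x x)                ∎
  where
  open ≡-Reasoning
  D = ∑[ x ≤ k ] ∑[ y ≤ k ] T x y
  Z = ∑[ x ≤ k ] T x (suc k)
  t = T (suc k) (suc k)
  rearrange : ∀ d z t → (d + z) + (z + t) ≡ (d + t) + (z + z)
  rearrange = solve-∀
  split : ∑[ x ≤ suc k ] ∑[ y ≤ suc k ] T x y ≡ (D + t) + (Z + Z)
  split = begin
    ∑[ x ≤ k ] (∑[ y ≤ k ] T x y + T x (suc k)) + (∑[ y ≤ k ] T (suc k) y + t)
      ≡⟨ cong₂ _+_ (∑≤-distrib-+ k (λ x → ∑[ y ≤ k ] T x y) (λ x → T x (suc k)))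
                   (cong (_+ t) (∑≤-cong k (T-sym (suc k)))) ⟩
    (D + Z) + (Z + t)
      ≡⟨ rearrange D Z t ⟩
    (D + t) + (Z + Z) ∎

double : ℕ → ℕ
double zero    = zero
double (suc n) = suc (suc (double n))

double≡+ : ∀ n → double n ≡ n + n
double≡+ zero    = refl
double≡+ (suc n) = cong suc (trans (cong suc (double≡+ n)) (sym (+-suc n n)))

double-* : ∀ w x → double w * x ≡ double (w * x)
double-* w x = begin
  double w * x      ≡⟨ cong (_* x) (double≡+ w) ⟩
  (w + w) * x       ≡⟨ *-distribʳ-+ x w w ⟩
  w * x + w * x     ≡⟨ double≡+ (w * x) ⟨
  double (w * x)    ∎
  where open ≡-Reasoning

n≤double : ∀ n → n ≤ double n
n≤double zero    = z≤n
n≤double (suc n) = s≤s (m≤n⇒m≤1+n (n≤double n))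

double-mono-≤ : ∀ {a k} → a ≤ k → double a ≤ double k
double-mono-≤ z≤n       = z≤n
double-mono-≤ (s≤s a≤k) = s≤s (s≤s (double-mono-≤ a≤k))

double-cancel-≤ : ∀ a k → double a ≤ suc (double k) → a ≤ k
double-cancel-≤ zero    k       _                 = z≤n
double-cancel-≤ (suc a) zero    (s≤s ())
double-cancel-≤ (suc a) (suc k) (s≤s (s≤s 2a≤1+2k)) = s≤s (double-cancel-≤ a k 2a≤1+2k)

double-∸ : ∀ k a → double k ∸ double a ≡ double (k ∸ a)
double-∸ k       zero    = refl
double-∸ zero    (suc a) = refl
double-∸ (suc k) (suc a) = double-∸ k a

suc-double-∸ : ∀ k a → a ≤ k → suc (double k) ∸ double a ≡ suc (double (k ∸ a))
suc-double-∸ k       zero    _         = refl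
suc-double-∸ (suc k) (suc a) (s≤s a≤k) = suc-double-∸ k a a≤k

data DoubleView : ℕ → Set where
  even : ∀ k → DoubleView (double k)
  odd  : ∀ k → DoubleView (suc (double k))

doubleView : ∀ n → DoubleView n
doubleView zero = even 0
doubleView (suc n) with doubleView n
... | even k = odd k
... | odd  k = even (suc k)

-- Counting multiplicity vectors of a given weight

shift : ℕ → (ℕ → ℕ) → ℕ → ℕ
shift a F m with a ≤? m
... | yes _ = F (m ∸ a)
... | no  _ = 0

shift-≤ : ∀ {a m} F → a ≤ m → shift a F m ≡ F (m ∸ a)
shift-≤ {a} {m} F a≤m with a ≤? m
... | yes _   = refl
... | no  a≰m = contradiction a≤m a≰m

shift-≰ : ∀ {a m} F → ¬ a ≤ m → shift a F m ≡ 0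
shift-≰ {a} {m} F a≰m with a ≤? m
... | yes a≤m = contradiction a≤m a≰m
... | no  _   = refl

shift-cong : ∀ a {F G} → F ≗ G → shift a F ≗ shift a G
shift-cong a F≗G m with a ≤? m
... | yes _ = F≗G (m ∸ a)
... | no  _ = refl

shift-cong-≡₂ : ∀ a F G → (∀ m → F m ≡₂ G m) → ∀ m → shift a F m ≡₂ shift a G m
shift-cong-≡₂ a F G F≡₂G m with a ≤? m
... | yes _ = F≡₂G (m ∸ a)
... | no  _ = refl

shift-shift : ∀ a b F m → shift a (shift b F) m ≡ shift (a + b) F m
shift-shift a b F m with a ≤? m
... | no a≰m = sym (shift-≰ F (λ a+b≤m → a≰m (≤-trans (m≤m+n a b) a+b≤m)))
... | yes a≤m with b ≤? m ∸ a
...   | yes b≤m∸a = trans (cong F (∸-+-assoc m a b))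
                     (sym (shift-≤ F (subst (_≤ m) (+-comm b a) (m≤o∸n⇒m+n≤o b a≤m b≤m∸a))))
...   | no  b≰m∸a = sym (shift-≰ F (λ a+b≤m → b≰m∸a (m+n≤o⇒m≤o∸n b (subst (_≤ m) (+-comm a b) a+b≤m))))

shift-∑≤ : ∀ a k (H : ℕ → ℕ → ℕ) m → shift a (λ m′ → ∑[ y ≤ k ] H y m′) m ≡ ∑[ y ≤ k ] shift a (H y) m
shift-∑≤ a k H m with a ≤? m
... | yes _ = refl
... | no  _ = sym (∑≤-zero k)

shift-double : ∀ a k F → shift (double a) F (double k) ≡ shift a (λ k′ → F (double k′)) k
shift-double a k F with a ≤? k
... | yes a≤k = trans (shift-≤ F (double-mono-≤ a≤k)) (cong F (double-∸ k a))
... | no  a≰k = shift-≰ F (λ 2a≤2k → a≰k (double-cancel-≤ a k (m≤n⇒m≤1+n 2a≤2k)))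

shift-double-odd : ∀ a k F → (∀ j → F (suc (double j)) ≡ 0) → shift (double a) F (suc (double k)) ≡ 0
shift-double-odd a k F F-odd≡0 with double a ≤? suc (double k)
... | yes 2a≤1+2k = trans (cong F (suc-double-∸ k a (double-cancel-≤ a k 2a≤1+2k))) (F-odd≡0 (k ∸ a))
... | no  _       = refl

-- The coefficient of q^m in ∏_{w ∈ ws} (1 + q^w + ⋯ + q^{Bw}). Capping multiplicities at B
-- lets every sum range over the same interval; for B ≥ m the cap is invisible.
count : ℕ → List ℕ → ℕ → ℕ
count B []       zero    = 1
count B []       (suc _) = 0
count B (w ∷ ws) m       = ∑[ x ≤ B ] shift (w * x) (count B ws) m

count-cong-∷ : ∀ B w ws ws′ → count B ws ≗ count B ws′ → count B (w ∷ ws) ≗ count B (w ∷ ws′)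
count-cong-∷ B w ws ws′ ws≗ws′ m = ∑≤-cong B (λ x → shift-cong (w * x) ws≗ws′ m)

count-∷-∷ : ∀ B w v ws m →
  count B (w ∷ v ∷ ws) m ≡ ∑[ x ≤ B ] ∑[ y ≤ B ] shift (w * x + v * y) (count B ws) m
count-∷-∷ B w v ws m = ∑≤-cong B λ x →
  trans (shift-∑≤ (w * x) B (λ y → shift (v * y) (count B ws)) m)
          (∑≤-cong B λ y → shift-shift (w * x) (v * y) (count B ws) m)

count-swap : ∀ B w v ws → count B (w ∷ v ∷ ws) ≗ count B (v ∷ w ∷ ws)
count-swap B w v ws m = begin
  count B (w ∷ v ∷ ws) m                                           ≡⟨ count-∷-∷ B w v ws m ⟩
  ∑[ x ≤ B ] ∑[ y ≤ B ] shift (w * x + v * y) (count B ws) m      ≡⟨ ∑≤-comm B B _ ⟩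
  ∑[ y ≤ B ] ∑[ x ≤ B ] shift (w * x + v * y) (count B ws) m      ≡⟨ ∑≤-cong B (λ y → ∑≤-cong B λ x →
                                                                       cong (λ a → shift a (count B ws) m) (+-comm (w * x) (v * y))) ⟩
  ∑[ y ≤ B ] ∑[ x ≤ B ] shift (v * y + w * x) (count B ws) m      ≡⟨ count-∷-∷ B v w ws m ⟨
  count B (v ∷ w ∷ ws) m                                           ∎
  where open ≡-Reasoning

count-↭ : ∀ B {ws ws′} → ws ↭ ws′ → count B ws ≗ count B ws′
count-↭ B ↭.refl                                _ = refl
count-↭ B (↭.prep {xs = ws} {ys = ws′} w p)       = count-cong-∷ B w ws ws′ (count-↭ B p)
count-↭ B (↭.swap {xs = ws} {ys = ws′} w v p)   m = trans
  (count-cong-∷ B w (v ∷ ws) (v ∷ ws′) (count-cong-∷ B v ws ws′ (count-↭ B p)) m)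
  (count-swap B w v ws′ m)
count-↭ B (↭.trans p q)                         m = trans (count-↭ B p m) (count-↭ B q m)

count-cong-∷-≡₂ : ∀ B w ws ws′ → (∀ m → count B ws m ≡₂ count B ws′ m) →
  ∀ m → count B (w ∷ ws) m ≡₂ count B (w ∷ ws′) m
count-cong-∷-≡₂ B w ws ws′ ws≡₂ws′ m = ∑≤-cong-≡₂ B _ _ λ x →
  shift-cong-≡₂ (w * x) (count B ws) (count B ws′) ws≡₂ws′ m

count-cong-++-≡₂ : ∀ B A ws ws′ → (∀ m → count B ws m ≡₂ count B ws′ m) →
  ∀ m → count B (A ++ ws) m ≡₂ count B (A ++ ws′) m
count-cong-++-≡₂ B []      ws ws′ ws≡₂ws′ = ws≡₂ws′
count-cong-++-≡₂ B (a ∷ A) ws ws′ ws≡₂ws′ =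
  count-cong-∷-≡₂ B a (A ++ ws) (A ++ ws′) (count-cong-++-≡₂ B A ws ws′ ws≡₂ws′)

count-drop : ∀ B {w} ws {m} → m < w → count B (w ∷ ws) m ≡ count B ws m
count-drop B {w} ws {m} m<w = begin
  ∑[ x ≤ B ] shift (w * x) (count B ws) m  ≡⟨ ∑≤-head B _ (λ x → shift-≰ (count B ws) (w*[1+x]≰m x)) ⟩
  shift (w * 0) (count B ws) m             ≡⟨ cong (λ a → shift a (count B ws) m) (*-zeroʳ w) ⟩
  shift 0 (count B ws) m                   ≡⟨ shift-≤ (count B ws) z≤n ⟩
  count B ws m                             ∎
  where
  open ≡-Reasoning
  w*[1+x]≰m : ∀ x → ¬ w * suc x ≤ m
  w*[1+x]≰m x w*[1+x]≤m = <⇒≱ m<w (≤-trans (m≤m*n w (suc x)) w*[1+x]≤m)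

count-drop-++ : ∀ B {H} ws {m} → All (m <_) H → count B (H ++ ws) m ≡ count B ws m
count-drop-++ B ws []                             = refl
count-drop-++ B ws {m} (_∷_ {xs = H} m<h m<H) =
  trans (count-drop B (H ++ ws) m<h) (count-drop-++ B ws m<H)

count-map-double : ∀ B ws k → count B (map double ws) (double k) ≡ count B ws k
count-map-double B []       zero    = refl
count-map-double B []       (suc k) = refl
count-map-double B (w ∷ ws) k       = ∑≤-cong B λ x → begin
  shift (double w * x) (count B (map double ws)) (double k)  ≡⟨ cong (λ a → shift a _ (double k)) (double-* w x) ⟩
  shift (double (w * x)) (count B (map double ws)) (double k) ≡⟨ shift-double (w * x) k _ ⟩
  shift (w * x) (λ k′ → count B (map double ws) (double k′)) k ≡⟨ shift-cong (w * x) (count-map-double B ws) k ⟩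
  shift (w * x) (count B ws) k                                 ∎
  where open ≡-Reasoning

count-map-double-odd : ∀ B ws k → count B (map double ws) (suc (double k)) ≡ 0
count-map-double-odd B []       k = refl
count-map-double-odd B (w ∷ ws) k = trans
  (∑≤-cong B λ x → trans (cong (λ a → shift a C (suc (double k))) (double-* w x))
                           (shift-double-odd (w * x) k C (count-map-double-odd B ws)))
  (∑≤-zero B)
  where C = count B (map double ws)

-- Mod 2, (1 + q^w + ⋯ + q^{Bw})² ≡ 1 + q^{2w} + ⋯ + q^{2Bw}.
count-merge : ∀ B w ws m → count B (w ∷ w ∷ ws) m ≡₂ count B (double w ∷ ws) m
count-merge B w ws m = begin
  parity (count B (w ∷ w ∷ ws) m)                         ≡⟨ cong parity (count-∷-∷ B w w ws m) ⟩
  parity (∑[ x ≤ B ] ∑[ y ≤ B ] shift (w * x + w * y) C m) ≡⟨ ∑≤-symmetric-≡₂ B _ T-sym ⟩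
  parity (∑[ x ≤ B ] shift (w * x + w * x) C m)           ≡⟨ cong parity (∑≤-cong B λ x →
                                                                 cong (λ a → shift a C m) (w*x+w*x≡2w*x x)) ⟩
  parity (count B (double w ∷ ws) m)                      ∎
  where
  open ≡-Reasoning
  C = count B ws
  T-sym : ∀ x y → shift (w * x + w * y) C m ≡ shift (w * y + w * x) C m
  T-sym x y = cong (λ a → shift a C m) (+-comm (w * x) (w * y))
  w*x+w*x≡2w*x : ∀ x → w * x + w * x ≡ double w * x
  w*x+w*x≡2w*x x = trans (sym (double≡+ (w * x))) (sym (double-* w x))

count-merge-++ : ∀ B P m → count B (P ++ P) m ≡₂ count B (map double P) m
count-merge-++ B []      m = refl
count-merge-++ B (w ∷ P) m = begin
  parity (count B (w ∷ P ++ w ∷ P) m)       ≡⟨ cong parity (count-↭ B (prep w (↭-shift w P P)) m) ⟩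
  parity (count B (w ∷ w ∷ P ++ P) m)       ≡⟨ count-merge B w (P ++ P) m ⟩
  parity (count B (double w ∷ P ++ P) m)    ≡⟨ count-cong-∷-≡₂ B (double w) (P ++ P) (map double P) (count-merge-++ B P) m ⟩
  parity (count B (double w ∷ map double P) m) ∎
  where open ≡-Reasoning

count-rearrange : ∀ B A P H m → All (m <_) H →
  count B ((A ++ P) ++ (H ++ P)) m ≡₂ count B (A ++ map double P) m
count-rearrange B A P H m m<H = begin
  parity (count B ((A ++ P) ++ (H ++ P)) m) ≡⟨ cong parity (count-↭ B perm m) ⟩
  parity (count B (H ++ A ++ P ++ P) m)     ≡⟨ cong parity (count-drop-++ B (A ++ P ++ P) m<H) ⟩
  parity (count B (A ++ P ++ P) m)          ≡⟨ count-cong-++-≡₂ B A (P ++ P) (map double P) (count-merge-++ B P) m ⟩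
  parity (count B (A ++ map double P) m)    ∎
  where
  open ≡-Reasoning
  perm : (A ++ P) ++ (H ++ P) ↭ H ++ A ++ P ++ P
  perm = ↭-trans (++-comm (A ++ P) (H ++ P)) (↭-trans (↭-reflexive (++-assoc H P (A ++ P)))
           (++⁺ˡ H (↭-trans (↭-reflexive (sym (++-assoc P A P)))
           (↭-trans (++⁺ʳ P (++-comm P A)) (↭-reflexive (++-assoc A P P))))))

-- The parity of j(n)

nats : ℕ → List ℕ
nats zero    = []
nats (suc k) = suc k ∷ nats k

odds : ℕ → List ℕ
odds zero    = []
odds (suc k) = suc (double k) ∷ odds k

weights : ℕ → List ℕ
weights zero    = []
weights (suc k) = suc k ∷ suc (double k) ∷ weights k

weights-↭ : ∀ k → weights k ↭ nats k ++ odds k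
weights-↭ zero    = ↭-refl
weights-↭ (suc k) = prep (suc k) (↭-trans (prep _ (weights-↭ k)) (↭-sym (↭-shift _ (nats k) (odds k))))

nats-double-↭ : ∀ k → nats (double k) ↭ map double (nats k) ++ odds k
nats-double-↭ zero    = ↭-refl
nats-double-↭ (suc k) =
  prep _ (↭-trans (prep _ (nats-double-↭ k)) (↭-sym (↭-shift _ (map double (nats k)) (odds k))))

nats-suc-double-↭ : ∀ k → nats (suc (double k)) ↭ map double (nats k) ++ odds (suc k)
nats-suc-double-↭ k =
  ↭-trans (prep _ (nats-double-↭ k)) (↭-sym (↭-shift _ (map double (nats k)) (odds k)))

odds-+ : ∀ j k → Σ (List ℕ) λ H → odds (j + k) ≡ H ++ odds k × All (double k <_) H
odds-+ zero    k = [] , refl , []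
odds-+ (suc j) k with odds-+ j k
... | H , odds≡ , 2k<H =
  suc (double (j + k)) ∷ H , cong (_ ∷_) odds≡ , s≤s (double-mono-≤ (m≤n+m k j)) ∷ 2k<H

count-weights-double : ∀ B k → count B (weights (double k)) (double k) ≡₂ count B (weights k) k
count-weights-double B k with odds-+ k k
... | H , odds≡ , 2k<H = begin
  parity (count B (weights (double k)) (double k))
    ≡⟨ cong parity (count-↭ B perm (double k)) ⟩
  parity (count B ((map double (nats k) ++ odds k) ++ (H ++ odds k)) (double k))
    ≡⟨ count-rearrange B (map double (nats k)) (odds k) H (double k) 2k<H ⟩
  parity (count B (map double (nats k) ++ map double (odds k)) (double k))
    ≡⟨ cong parity (count-↭ B (↭-reflexive (sym (map-++ double (nats k) (odds k)))) (double k)) ⟩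
  parity (count B (map double (nats k ++ odds k)) (double k))
    ≡⟨ cong parity (count-↭ B (map⁺ double (↭-sym (weights-↭ k))) (double k)) ⟩
  parity (count B (map double (weights k)) (double k))
    ≡⟨ cong parity (count-map-double B (weights k) k) ⟩
  parity (count B (weights k) k) ∎
  where
  open ≡-Reasoning
  perm : weights (double k) ↭ (map double (nats k) ++ odds k) ++ (H ++ odds k)
  perm = ↭-trans (weights-↭ (double k))
           (++⁺ (nats-double-↭ k) (↭-reflexive (trans (cong odds (double≡+ k)) odds≡)))

count-weights-suc-double : ∀ B k → count B (weights (suc (double k))) (suc (double k)) ≡₂ 0
count-weights-suc-double B k with odds-+ k (suc k)
... | H , odds≡ , 2[1+k]<H = begin
  parity (count B (weights (suc (double k))) (suc (double k)))
    ≡⟨ cong parity (count-↭ B perm (suc (double k))) ⟩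
  parity (count B ((map double (nats k) ++ odds (suc k)) ++ (H ++ odds (suc k))) (suc (double k)))
    ≡⟨ count-rearrange B (map double (nats k)) (odds (suc k)) H (suc (double k))
         (All.map (<-trans (n<1+n _)) 2[1+k]<H) ⟩
  parity (count B (map double (nats k) ++ map double (odds (suc k))) (suc (double k)))
    ≡⟨ cong parity (count-↭ B (↭-reflexive (sym (map-++ double (nats k) (odds (suc k))))) (suc (double k))) ⟩
  parity (count B (map double (nats k ++ odds (suc k))) (suc (double k)))
    ≡⟨ cong parity (count-map-double-odd B (nats k ++ odds (suc k)) k) ⟩
  parity 0 ∎
  where
  open ≡-Reasoning
  1+2k≡k+[1+k] : suc (double k) ≡ k + suc k
  1+2k≡k+[1+k] = trans (cong suc (double≡+ k)) (sym (+-suc k k))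
  perm : weights (suc (double k)) ↭ (map double (nats k) ++ odds (suc k)) ++ (H ++ odds (suc k))
  perm = ↭-trans (weights-↭ (suc (double k)))
           (++⁺ (nats-suc-double-↭ k) (↭-reflexive (trans (cong odds 1+2k≡k+[1+k]) odds≡)))

count-weights-≡₂0 : ∀ B n → 1 ≤ n → count B (weights n) n ≡₂ 0
count-weights-≡₂0 B = <-rec _ step
  where
  step : ∀ n → (∀ {m} → m < n → 1 ≤ m → count B (weights m) m ≡₂ 0) → 1 ≤ n → count B (weights n) n ≡₂ 0
  step n rec 1≤n with doubleView n
  ... | odd  k       = count-weights-suc-double B k
  ... | even (suc k) = trans (count-weights-double B (suc k))
                               (rec (s≤s (s≤s (n≤double k))) (s≤s z≤n))

-- Enumerating multiplicity vectors

⋃≤ : ℕ → (ℕ → List A) → List A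
⋃≤ zero    F = F zero
⋃≤ (suc k) F = ⋃≤ k F ++ F (suc k)

syntax ⋃≤ k (λ x → e) = ⋃[ x ≤ k ] e

shiftL : ℕ → (ℕ → List A) → ℕ → List A
shiftL a F m with a ≤? m
... | yes _ = F (m ∸ a)
... | no  _ = []

solutions : ℕ → List ℕ → ℕ → List (List ℕ)
solutions B []       zero    = [] ∷ []
solutions B []       (suc _) = []
solutions B (w ∷ ws) m       = ⋃[ x ≤ B ] shiftL (w * x) (λ m′ → map (x ∷_) (solutions B ws m′)) m

length-⋃≤ : ∀ k (F : ℕ → List A) → length (⋃≤ k F) ≡ ∑[ x ≤ k ] length (F x)
length-⋃≤ zero    F = refl
length-⋃≤ (suc k) F = trans (length-++ (⋃≤ k F)) (cong (_+ length (F (suc k))) (length-⋃≤ k F))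

length-shiftL : ∀ a (F : ℕ → List A) m → length (shiftL a F m) ≡ shift a (λ m′ → length (F m′)) m
length-shiftL a F m with a ≤? m
... | yes _ = refl
... | no  _ = refl

length-solutions : ∀ B ws m → length (solutions B ws m) ≡ count B ws m
length-solutions B []       zero    = refl
length-solutions B []       (suc m) = refl
length-solutions B (w ∷ ws) m       = trans (length-⋃≤ B _) (∑≤-cong B λ x →
  trans (length-shiftL (w * x) _ m) (shift-cong (w * x) (λ m′ →
    trans (length-map (x ∷_) (solutions B ws m′)) (length-solutions B ws m′)) m))

∈-⋃≤⁻ : ∀ k (F : ℕ → List A) {v : A} → v ∈ ⋃≤ k F → Σ ℕ λ x → x ≤ k × v ∈ F x
∈-⋃≤⁻ zero    F v∈ = 0 , z≤n , v∈
∈-⋃≤⁻ (suc k) F v∈ with ∈-++⁻ (⋃≤ k F) v∈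
... | inj₁ v∈⋃ = let x , x≤k , v∈Fx = ∈-⋃≤⁻ k F v∈⋃ in x , m≤n⇒m≤1+n x≤k , v∈Fx
... | inj₂ v∈F = suc k , ≤-refl , v∈F

∈-⋃≤⁺ : ∀ k (F : ℕ → List A) {v : A} {x} → x ≤ k → v ∈ F x → v ∈ ⋃≤ k F
∈-⋃≤⁺ zero    F z≤n v∈ = v∈
∈-⋃≤⁺ (suc k) F x≤1+k v∈ with m≤n⇒m<n∨m≡n x≤1+k
... | inj₁ x<1+k  = ∈-++⁺ˡ (∈-⋃≤⁺ k F (s≤s⁻¹ x<1+k) v∈)
... | inj₂ refl = ∈-++⁺ʳ (⋃≤ k F) v∈

∈-shiftL⁻ : ∀ a (F : ℕ → List A) m {v : A} → v ∈ shiftL a F m → a ≤ m × v ∈ F (m ∸ a)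
∈-shiftL⁻ a F m v∈ with a ≤? m
... | yes a≤m = a≤m , v∈
... | no  _   with v∈
...   | ()

∈-shiftL⁺ : ∀ a (F : ℕ → List A) {m} {v : A} → a ≤ m → v ∈ F (m ∸ a) → v ∈ shiftL a F m
∈-shiftL⁺ a F {m} a≤m v∈ with a ≤? m
... | yes _   = v∈
... | no  a≰m = contradiction a≤m a≰m

_·_ : List ℕ → List ℕ → ℕ
ws · v = sum (zipWith _*_ ws v)

∈-solutions⁻ : ∀ B ws m {v} → v ∈ solutions B ws m → length v ≡ length ws × ws · v ≡ m
∈-solutions⁻ B []       zero    (here refl) = refl , refl
∈-solutions⁻ B (w ∷ ws) m       v∈ with ∈-⋃≤⁻ B _ v∈
... | x , _ , v∈shift with ∈-shiftL⁻ (w * x) _ m v∈shift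
... | w*x≤m , v∈map with ∈-map⁻ (x ∷_) v∈map
... | u , u∈ , refl with ∈-solutions⁻ B ws (m ∸ w * x) u∈
... | length≡ , ws·u≡ = cong suc length≡ , trans (cong (w * x +_) ws·u≡) (m+[n∸m]≡n w*x≤m)

∈-solutions⁺ : ∀ B ws m {v} → length v ≡ length ws → ws · v ≡ m → All (_≤ B) v → v ∈ solutions B ws m
∈-solutions⁺ B []       zero    {[]}    _        _      _ = here refl
∈-solutions⁺ B (w ∷ ws) m       {x ∷ u} length≡ ws·v≡m (x≤B ∷ u≤B) =
  ∈-⋃≤⁺ B _ x≤B (∈-shiftL⁺ (w * x) _ w*x≤m (∈-map⁺ (x ∷_)
    (∈-solutions⁺ B ws (m ∸ w * x) (suc-injective length≡) ws·u≡ u≤B)))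
  where
  w*x≤m : w * x ≤ m
  w*x≤m = subst (w * x ≤_) ws·v≡m (m≤m+n (w * x) (ws · u))
  ws·u≡ : ws · u ≡ m ∸ w * x
  ws·u≡ = trans (sym (m+n∸m≡n (w * x) (ws · u))) (cong (_∸ w * x) ws·v≡m)

Unique-⋃≤ : ∀ k (F : ℕ → List A) → (∀ x → Unique (F x)) →
  (∀ {x y v} → v ∈ F x → v ∈ F y → x ≡ y) → Unique (⋃≤ k F)
Unique-⋃≤ zero    F F-unique F-disjoint = F-unique 0
Unique-⋃≤ (suc k) F F-unique F-disjoint =
  Unique.++⁺ (Unique-⋃≤ k F F-unique F-disjoint) (F-unique (suc k)) λ (v∈⋃ , v∈F) →
    let x , x≤k , v∈Fx = ∈-⋃≤⁻ k F v∈⋃ in <⇒≢ (s≤s x≤k) (F-disjoint v∈Fx v∈F)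

Unique-shiftL : ∀ a (F : ℕ → List A) m → Unique (F (m ∸ a)) → Unique (shiftL a F m)
Unique-shiftL a F m unique with a ≤? m
... | yes _ = unique
... | no  _ = []

Unique-solutions : ∀ B ws m → Unique (solutions B ws m)
Unique-solutions B []       zero    = [] ∷ []
Unique-solutions B []       (suc m) = []
Unique-solutions B (w ∷ ws) m       = Unique-⋃≤ B _
  (λ x → Unique-shiftL (w * x) _ m (Unique.map⁺ ∷-injectiveʳ (Unique-solutions B ws (m ∸ w * x))))
  (λ {x} {y} v∈x v∈y → head-≡ (proj₂ (∈-shiftL⁻ (w * x) _ m v∈x)) (proj₂ (∈-shiftL⁻ (w * y) _ m v∈y)))
  where
  head-≡ : ∀ {x y v us us′} → v ∈ map (x ∷_) us → v ∈ map (y ∷_) us′ → x ≡ y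
  head-≡ {x} {y} v∈x v∈y with ∈-map⁻ (x ∷_) v∈x | ∈-map⁻ (y ∷_) v∈y
  ... | _ , _ , refl | _ , _ , x∷u≡y∷u′ = ∷-injectiveˡ x∷u≡y∷u′

Unique-map⁺ : ∀ {B : Set} (f : A → B) {xs} → (∀ {x y} → x ∈ xs → y ∈ xs → f x ≡ f y → x ≡ y) →
  Unique xs → Unique (map f xs)
Unique-map⁺ f f-inj []         = []
Unique-map⁺ f f-inj (x∉ ∷ xs!) =
  All.map⁺ (All.tabulate λ y∈ fx≡fy → All.lookup x∉ y∈ (f-inj (here refl) (there y∈) fx≡fy))
  ∷ Unique-map⁺ f (λ x∈ y∈ → f-inj (there x∈) (there y∈)) xs!

-- 01-partitions as multiplicity vectors

pairs : ℕ → ℕ → List ℕ → List ℕ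
pairs zero    K t = t
pairs (suc b) K t = K ∷ suc K ∷ pairs b K t

-- jagged K (a_K ∷ b_K ∷ ⋯ ∷ a_1 ∷ b_1 ∷ []) = K^{a_K} ((K−1) K)^{b_K} ⋯ 1^{a_1} (0 1)^{b_1}
jagged : ℕ → List ℕ → List ℕ
jagged (suc K) (a ∷ b ∷ v) = replicate a (suc K) ++ pairs b K (jagged K v)
jagged _       _           = []

Head≤ : ℕ → List ℕ → Set
Head≤ p []      = ⊤
Head≤ p (x ∷ _) = x ≤ p

-- On a 01-partition this bounds every entry, since n_{j+2} ≤ n_j.
Bounded : ℕ → ℕ → List ℕ → Set
Bounded p q []      = ⊤
Bounded p q (x ∷ t) = x ≤ p × Head≤ q t

Admissible : ℕ → List ℕ → Set
Admissible x []      = 1 ≤ x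
Admissible x (b ∷ t) = b ∸ 1 ≤ x × Head≤ x t

JaggedConds-∷ : ∀ x s → Admissible x s → JaggedConds s → JaggedConds (x ∷ s)
JaggedConds-∷ x []          1≤x           _  = 1≤x
JaggedConds-∷ x (b ∷ [])    (b∸1≤x , _)   js = b∸1≤x , js
JaggedConds-∷ x (b ∷ c ∷ _) (b∸1≤x , c≤x) js = b∸1≤x , c≤x , js

JaggedConds-∷⁻ : ∀ x s → JaggedConds (x ∷ s) → Admissible x s × JaggedConds s
JaggedConds-∷⁻ x []          1≤x               = 1≤x , tt
JaggedConds-∷⁻ x (b ∷ [])    (b∸1≤x , js)      = (b∸1≤x , tt) , js
JaggedConds-∷⁻ x (b ∷ c ∷ _) (b∸1≤x , c≤x , js) = (b∸1≤x , c≤x) , js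

Head≤-mono : ∀ {p p′} t → p ≤ p′ → Head≤ p t → Head≤ p′ t
Head≤-mono []      _    _   = tt
Head≤-mono (x ∷ _) p≤p′ x≤p = ≤-trans x≤p p≤p′

Bounded-mono : ∀ {p p′ q q′} s → p ≤ p′ → q ≤ q′ → Bounded p q s → Bounded p′ q′ s
Bounded-mono []      _    _    _         = tt
Bounded-mono (x ∷ t) p≤p′ q≤q′ (x≤p , h) = ≤-trans x≤p p≤p′ , Head≤-mono t q≤q′ h

Bounded⇒Head≤ : ∀ {p q} s → Bounded p q s → Head≤ p s
Bounded⇒Head≤ []      _         = tt
Bounded⇒Head≤ (x ∷ _) (x≤p , _) = x≤p

Bounded-tail : ∀ {q x} t → Head≤ q t → Admissible x t → Bounded q x t
Bounded-tail []      _   _         = tt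
Bounded-tail (_ ∷ _) c≤q (_ , h)   = c≤q , h

Bounded⇒Admissible : ∀ {x} t → Bounded (suc x) (suc x) t → Admissible (suc x) t
Bounded⇒Admissible []      _         = s≤s z≤n
Bounded⇒Admissible (b ∷ _) (b≤x , h) = ≤-trans (m∸n≤m b 1) b≤x , h

replicate-sound : ∀ a K u → JaggedConds u → Bounded (suc K) (suc K) u →
  JaggedConds (replicate a (suc K) ++ u) × Bounded (suc K) (suc K) (replicate a (suc K) ++ u)
replicate-sound zero    K u ju bu = ju , bu
replicate-sound (suc a) K u ju bu =
  JaggedConds-∷ (suc K) t (Bounded⇒Admissible t bt) jt , ≤-refl , Bounded⇒Head≤ t bt
  where
  t = replicate a (suc K) ++ u
  jt = proj₁ (replicate-sound a K u ju bu)
  bt = proj₂ (replicate-sound a K u ju bu)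

pairs-sound : ∀ b K t → JaggedConds t → Bounded K (suc K) t →
  JaggedConds (pairs b K t) × Bounded K (suc K) (pairs b K t)
pairs-sound zero    K t jt bt = jt , bt
pairs-sound (suc b) K t jt bt = JaggedConds-∷ K (suc K ∷ p) (≤-refl , Bounded⇒Head≤ p bp)
  (JaggedConds-∷ (suc K) p (Bounded⇒Admissible p (Bounded-mono p (n≤1+n K) ≤-refl bp)) jp)
  , ≤-refl , ≤-refl
  where
  p = pairs b K t
  jp = proj₁ (pairs-sound b K t jt bt)
  bp = proj₂ (pairs-sound b K t jt bt)

jagged-sound : ∀ K v → JaggedConds (jagged K v) × Bounded K K (jagged K v)
jagged-sound zero    _           = tt , tt
jagged-sound (suc K) []          = tt , tt
jagged-sound (suc K) (_ ∷ [])    = tt , tt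
jagged-sound (suc K) (a ∷ b ∷ v) = replicate-sound a K p jp (Bounded-mono p (n≤1+n K) ≤-refl bp)
  where
  t = jagged K v
  p = pairs b K t
  bt = Bounded-mono t ≤-refl (n≤1+n K) (proj₂ (jagged-sound K v))
  jp = proj₁ (pairs-sound b K t (proj₁ (jagged-sound K v)) bt)
  bp = proj₂ (pairs-sound b K t (proj₁ (jagged-sound K v)) bt)

-- The last entry is positive, yet entries at alternate positions never exceed the first two.
Bounded-0-0 : ∀ s → JaggedConds s → Bounded 0 0 s → s ≡ []
Bounded-0-0 []      _  _          = refl
Bounded-0-0 (x ∷ t) js (x≤0 , h) with JaggedConds-∷⁻ x t js
... | adm , jt with Bounded-0-0 t jt (Bounded-mono t ≤-refl x≤0 (Bounded-tail t h adm))
... | refl = contradiction (≤-trans adm x≤0) λ ()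

strip-pairs : ∀ K s → JaggedConds s → Bounded K (suc K) s →
  Σ ℕ λ b → Σ (List ℕ) λ r → s ≡ pairs b K r × JaggedConds r × Bounded K K r
strip-pairs K []          _  _             = 0 , [] , refl , tt , tt
strip-pairs K (x ∷ [])    js bs            = 0 , x ∷ [] , refl , js , bs
strip-pairs K (x ∷ y ∷ t) js (x≤K , y≤1+K) with y ≟ suc K
... | no  y≢1+K = 0 , x ∷ y ∷ t , refl , js , x≤K , s≤s⁻¹ (≤∧≢⇒< y≤1+K y≢1+K)
... | yes refl with JaggedConds-∷⁻ x (suc K ∷ t) js
...   | (K≤x , t≤x) , js′ with JaggedConds-∷⁻ (suc K) t js′
...     | adm , jt with strip-pairs K t jt (Bounded-mono t x≤K ≤-refl (Bounded-tail t t≤x adm))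
...       | b , r , t≡ , jr , br =
  suc b , r , cong₂ _∷_ (≤-antisym x≤K K≤x) (cong (suc K ∷_) t≡) , jr , br

strip-replicate : ∀ K s → JaggedConds s → Bounded (suc K) (suc K) s →
  Σ ℕ λ a → Σ (List ℕ) λ u → s ≡ replicate a (suc K) ++ u × JaggedConds u × Bounded K (suc K) u
strip-replicate K []      _  _           = 0 , [] , refl , tt , tt
strip-replicate K (x ∷ t) js (x≤1+K , h) with x ≟ suc K
... | no  x≢1+K = 0 , x ∷ t , refl , js , s≤s⁻¹ (≤∧≢⇒< x≤1+K x≢1+K) , h
... | yes refl with JaggedConds-∷⁻ (suc K) t js
...   | adm , jt with strip-replicate K t jt (Bounded-tail t h adm)
...     | a , u , t≡ , ju , bu = suc a , u , cong (suc K ∷_) t≡ , ju , bu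

jagged-complete : ∀ K s → JaggedConds s → Bounded K K s →
  Σ (List ℕ) λ v → length v ≡ length (weights K) × jagged K v ≡ s
jagged-complete zero    s js bs = [] , refl , sym (Bounded-0-0 s js bs)
jagged-complete (suc K) s js bs with strip-replicate K s js bs
... | a , u , refl , ju , bu with strip-pairs K u ju bu
... | b , r , refl , jr , br with jagged-complete K r jr br
... | v , length≡ , refl = a ∷ b ∷ v , cong (λ n → suc (suc n)) length≡ , refl

replicate-++-injective : ∀ K a a′ {u u′} → Head≤ K u → Head≤ K u′ →
  replicate a (suc K) ++ u ≡ replicate a′ (suc K) ++ u′ → a ≡ a′ × u ≡ u′
replicate-++-injective K zero    zero     _  _   e = refl , e
replicate-++-injective K (suc a) (suc a′) hu hu′ e
  with replicate-++-injective K a a′ hu hu′ (∷-injectiveʳ e)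
... | a≡a′ , u≡u′ = cong suc a≡a′ , u≡u′
replicate-++-injective K (suc a) zero     _  hu′ e = ⊥-elim (1+n≰n (subst (Head≤ K) (sym e) hu′))
replicate-++-injective K zero    (suc a′) hu _   e = ⊥-elim (1+n≰n (subst (Head≤ K) e hu))

pairs-injective : ∀ K b b′ {r r′} → Bounded K K r → Bounded K K r′ →
  pairs b K r ≡ pairs b′ K r′ → b ≡ b′ × r ≡ r′
pairs-injective K zero    zero     _  _   e = refl , e
pairs-injective K (suc b) (suc b′) br br′ e
  with pairs-injective K b b′ br br′ (∷-injectiveʳ (∷-injectiveʳ e))
... | b≡b′ , r≡r′ = cong suc b≡b′ , r≡r′
pairs-injective K (suc b) zero     _  br′ e = ⊥-elim (1+n≰n (proj₂ (subst (Bounded K K) (sym e) br′)))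
pairs-injective K zero    (suc b′) br _   e = ⊥-elim (1+n≰n (proj₂ (subst (Bounded K K) e br)))

Head≤-pairs : ∀ b K t → Head≤ K t → Head≤ K (pairs b K t)
Head≤-pairs zero    K t h = h
Head≤-pairs (suc b) K t _ = ≤-refl

Head≤-jagged : ∀ K v → Head≤ K (jagged K v)
Head≤-jagged K v = Bounded⇒Head≤ (jagged K v) (proj₂ (jagged-sound K v))

jagged-injective : ∀ K {v v′} → length v ≡ length (weights K) → length v′ ≡ length (weights K) →
  jagged K v ≡ jagged K v′ → v ≡ v′
jagged-injective zero    {[]}        {[]}           _ _ _ = refl
jagged-injective (suc K) {a ∷ b ∷ w} {a′ ∷ b′ ∷ w′} l l′ e
  with replicate-++-injective K a a′ (Head≤-pairs b K _ (Head≤-jagged K w)) (Head≤-pairs b′ K _ (Head≤-jagged K w′)) e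
... | refl , e₁ with pairs-injective K b b′ (proj₂ (jagged-sound K w)) (proj₂ (jagged-sound K w′)) e₁
... | refl , e₂ = cong (λ w → a ∷ b ∷ w)
  (jagged-injective K (suc-injective (suc-injective l)) (suc-injective (suc-injective l′)) e₂)

sum-replicate-++ : ∀ a x t → sum (replicate a x ++ t) ≡ a * x + sum t
sum-replicate-++ zero    x t = refl
sum-replicate-++ (suc a) x t =
  trans (cong (x +_) (sum-replicate-++ a x t)) (sym (+-assoc x (a * x) (sum t)))

sum-pairs : ∀ b K t → sum (pairs b K t) ≡ b * suc (double K) + sum t
sum-pairs zero    K t = refl
sum-pairs (suc b) K t = begin
  K + (suc K + sum (pairs b K t))               ≡⟨ cong (λ z → K + (suc K + z)) (sum-pairs b K t) ⟩
  K + (suc K + (b * suc (double K) + sum t))    ≡⟨ regroup K (b * suc (double K)) (sum t) ⟩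
  suc (K + K) + b * suc (double K) + sum t      ≡⟨ cong (λ d → suc d + b * suc (double K) + sum t) (double≡+ K) ⟨
  suc (double K) + b * suc (double K) + sum t   ∎
  where
  open ≡-Reasoning
  regroup : ∀ K y z → K + (suc K + (y + z)) ≡ suc (K + K) + y + z
  regroup = solve-∀

sum-jagged : ∀ K v → length v ≡ length (weights K) → sum (jagged K v) ≡ weights K · v
sum-jagged zero    []          _ = refl
sum-jagged (suc K) (a ∷ b ∷ v) l = begin
  sum (replicate a (suc K) ++ pairs b K (jagged K v))     ≡⟨ sum-replicate-++ a (suc K) _ ⟩
  a * suc K + sum (pairs b K (jagged K v))                 ≡⟨ cong (a * suc K +_) (sum-pairs b K _) ⟩
  a * suc K + (b * suc (double K) + sum (jagged K v))     ≡⟨ cong₂ _+_ (*-comm a (suc K)) (cong₂ _+_ (*-comm b (suc (double K)))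
                                                               (sum-jagged K v (suc-injective (suc-injective l)))) ⟩
  suc K * a + (suc (double K) * b + weights K · v)        ∎
  where open ≡-Reasoning

Bounded-sum : ∀ s → Bounded (sum s) (sum s) s
Bounded-sum []          = tt
Bounded-sum (x ∷ [])    = m≤m+n x 0 , tt
Bounded-sum (x ∷ y ∷ t) = m≤m+n x (y + sum t) , ≤-trans (m≤m+n y (sum t)) (m≤n+m (y + sum t) x)

All-≤-· : ∀ ws v → All NonZero ws → length v ≡ length ws → All (_≤ ws · v) v
All-≤-· []       []      []          _ = []
All-≤-· (w ∷ ws) (x ∷ u) (w≢0 ∷ ws≢0) l =
  ≤-trans (m≤n*m x w ⦃ w≢0 ⦄) (m≤m+n (w * x) (ws · u))
  ∷ All.map (λ y≤ → ≤-trans y≤ (m≤n+m (ws · u) (w * x))) (All-≤-· ws u ws≢0 (suc-injective l))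

weights-nonZero : ∀ k → All NonZero (weights k)
weights-nonZero zero    = []
weights-nonZero (suc k) = nonZero ∷ nonZero ∷ weights-nonZero k

jaggedPartitions : ℕ → List (List ℕ)
jaggedPartitions n = map (jagged n) (solutions n (weights n) n)

Unique-jaggedPartitions : ∀ n → Unique (jaggedPartitions n)
Unique-jaggedPartitions n = Unique-map⁺ (jagged n)
  (λ v∈ v′∈ → jagged-injective n (proj₁ (∈-solutions⁻ n (weights n) n v∈)) (proj₁ (∈-solutions⁻ n (weights n) n v′∈)))
  (Unique-solutions n (weights n) n)

length-jaggedPartitions : ∀ n → length (jaggedPartitions n) ≡ count n (weights n) n
length-jaggedPartitions n =
  trans (length-map (jagged n) (solutions n (weights n) n)) (length-solutions n (weights n) n)

∈-map-jagged⁻ : ∀ B K m {s} → s ∈ map (jagged K) (solutions B (weights K) m) → Is01Partition m s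
∈-map-jagged⁻ B K m s∈ with ∈-map⁻ (jagged K) s∈
... | v , v∈ , refl with ∈-solutions⁻ B (weights K) m v∈
... | length≡ , weights·v≡m = trans (sum-jagged K v length≡) weights·v≡m , proj₁ (jagged-sound K v)

∈-jaggedPartitions⁺ : ∀ n {s} → Is01Partition n s → s ∈ jaggedPartitions n
∈-jaggedPartitions⁺ n {s} (sum≡n , js)
  with jagged-complete n s js (subst (λ m → Bounded m m s) sum≡n (Bounded-sum s))
... | v , length≡ , refl = ∈-map⁺ (jagged n) (∈-solutions⁺ n (weights n) n length≡ weights·v≡n
        (subst (λ m → All (_≤ m) v) weights·v≡n (All-≤-· (weights n) v (weights-nonZero n) length≡)))
  where
  weights·v≡n : weights n · v ≡ n
  weights·v≡n = trans (sym (sum-jagged n v length≡)) sum≡n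

corollary7 : (n : ℕ) → 1 < n →
    Σ (List (List ℕ)) (λ xs →
      Unique xs × ((s : List ℕ) → (s ∈ xs) ⇔ Is01Partition n s) × (2 ∣ length xs))
-- j(1) = 2 is even as well: only 1 ≤ n is used.
corollary7 n 1<n =
  jaggedPartitions n ,
  Unique-jaggedPartitions n ,
  (λ s → mk⇔ (∈-map-jagged⁻ n n n) (∈-jaggedPartitions⁺ n)) ,
  parity≡0ℙ⇒2∣ _ (trans (cong parity (length-jaggedPartitions n)) (count-weights-≡₂0 n n (<⇒≤ 1<n)))
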